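{- Let $G$ and $H$ be general coronas of some trees. Suppose that $G$ and $H$ share only one edge $xy$ (that is, $V(G)\cap V(H)=\{x,y\}$ and $E(G)\cap E(H)=\{xy\}$), where the same end vertex $x$ is an external vertex in both $G$ and $H$ (and hence $y$ is internal in both). Then the union $G\cup H$ is (isomorphic to) a general corona of some tree.
   Context: For a graph $T$, a vertex neighborhood partition is a family $\mathcal{P}=\{\mathcal{P}(v): v\in V(T)\}$ where each $\mathcal{P}(v)$ is a partition of $N_T(v)$ into nonempty parts. The general corona $T\circ\mathcal{P}$ has vertex set $\{(v,1): v\in V(T)\}\cup\bigcup_{v\in V(T)}\{(v,A): A\in\mathcal{P}(v)\}$ and edge set $\bigcup_{v}\{(v,1)(v,A): A\in\mathcal{P}(v)\}\cup\bigcup_{uv\in E(T)}\{(v,A)(u,B): u\in A,\ v\in B\}$. The vertices $(v,1)$ are called external; the others internal. A graph is a general corona of a tree if it equals $T\circ\mathcal{P}$ for some tree $T$ and some such $\mathcal{P}$. $G\cup H$ has vertex set $V(G)\cup V(H)$ and edge set $E(G)\cup E(H)$. -}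

module Defs where

open import Data.Nat using (ℕ; suc; _≤_)
open import Data.Fin using (Fin)
open import Data.Bool using (Bool; true; false; T; _∨_)
open import Data.Bool.Properties using (∨-comm)
open import Data.Maybe using (Maybe; just; nothing)
open import Data.List using (List; []; _∷_; _++_; [_]; length)
open import Data.List.Relation.Unary.Linked using (Linked)
open import Data.List.Relation.Unary.Unique.Propositional using (Unique)
open import Data.Product using (Σ; ∃; _×_; _,_; proj₁; proj₂)
open import Data.Sum using (_⊎_; inj₁; inj₂; [_,_]′)
open import Data.Empty using (⊥)
open import Relation.Binary.PropositionalEquality using (_≡_; refl; sym; cong; cong₂)
open import Relation.Nullary using (¬_)
open import Function.Bundles using (_↔_; Inverse)

module _ {n : ℕ} (adj : Fin n → Fin n → Bool) where

  data Walk : Fin n → Fin n → Set where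
    here : ∀ v → Walk v v
    step : ∀ u w v → T (adj u w) → Walk w v → Walk u v

  Connected : Set
  Connected = ∀ u v → Walk u v

  -- a cycle: distinct vertices v ∷ cs, at least 3 of them,
  -- with v - c₁ - ... - cₖ - v a closed walk
  IsCycle : Fin n → List (Fin n) → Set
  IsCycle v cs = (2 ≤ length cs) × Unique (v ∷ cs)
                 × Linked (λ a b → T (adj a b)) (v ∷ cs ++ [ v ])

  Acyclic : Set
  Acyclic = ∀ v cs → ¬ IsCycle v cs

record Tree : Set where
  field
    n         : ℕ
    adj       : Fin n → Fin n → Bool
    adj-sym   : ∀ u v → adj u v ≡ adj v u
    adj-irr   : ∀ v → adj v v ≡ false
    nonempty  : 1 ≤ n
    connected : Connected adj
    acyclic   : Acyclic adj

-- Vertex neighbourhood partitions: for each v, a partition of N_T(v)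
-- into k v nonempty (labelled) parts, given as a surjection
-- N_T(v) → Fin (k v).

record NbPartition (Tr : Tree) : Set where
  open Tree Tr
  field
    k    : Fin n → ℕ
    part : (v u : Fin n) → T (adj v u) → Fin (k v)
    surj : ∀ v (A : Fin (k v)) → ∃ λ u → Σ (T (adj v u)) λ p → part v u p ≡ A

-- General corona T ∘ P.
-- (v , nothing) is the external vertex (v,1); (v , just A) is (v,A).
module _ (Tr : Tree) (P : NbPartition Tr) where
  open Tree Tr
  open NbPartition P

  CVtx : Set
  CVtx = Σ (Fin n) λ v → Maybe (Fin (k v))

  CAdj : CVtx → CVtx → Set
  CAdj (v , nothing) (u , nothing) = ⊥
  CAdj (v , nothing) (u , just B)  = v ≡ u
  CAdj (v , just A)  (u , nothing) = v ≡ u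
  CAdj (v , just A)  (u , just B)  =
    (Σ (T (adj v u)) λ p → part v u p ≡ A)
    × (Σ (T (adj u v)) λ q → part u v q ≡ B)

IsExternal : {Tr : Tree} {P : NbPartition Tr} → CVtx Tr P → Set
IsExternal (v , a) = a ≡ nothing

record Graph (U : Set) : Set where
  field
    V     : U → Bool
    E     : U → U → Bool
    E-sym : ∀ u v → E u v ≡ E v u
    E-irr : ∀ v → E v v ≡ false
    E-V   : ∀ u v → T (E u v) → T (V u)

module _ {U : Set} where
  open Graph

  Vtx : Graph U → Set
  Vtx G = Σ U λ u → T (V G u)

  IsIso : (G : Graph U) (Tr : Tree) (P : NbPartition Tr) →
          Vtx G ↔ CVtx Tr P → Set
  IsIso G Tr P φ = ∀ (a b : Vtx G) →
    (T (E G (proj₁ a) (proj₁ b)) → CAdj Tr P (to a) (to b))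
    × (CAdj Tr P (to a) (to b) → T (E G (proj₁ a) (proj₁ b)))
    where open Inverse φ

  IsGenCorona : Graph U → Set
  IsGenCorona G = ∃ λ (Tr : Tree) → ∃ λ (P : NbPartition Tr) →
    Σ (Vtx G ↔ CVtx Tr P) λ φ → IsIso G Tr P φ

  IsGenCoronaExt : Graph U → U → Set
  IsGenCoronaExt G x = ∃ λ (Tr : Tree) → ∃ λ (P : NbPartition Tr) →
    Σ (Vtx G ↔ CVtx Tr P) λ φ → IsIso G Tr P φ
      × (∀ (px : T (V G x)) → IsExternal {Tr} {P} (Inverse.to φ (x , px)))

  private
    T-∨ : ∀ a b → T (a ∨ b) → T a ⊎ T b
    T-∨ true  b t = inj₁ t
    T-∨ false b t = inj₂ t

    T-∨ˡ : ∀ a b → T a → T (a ∨ b)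
    T-∨ˡ true b t = t

    T-∨ʳ : ∀ a b → T b → T (a ∨ b)
    T-∨ʳ true  b t = _
    T-∨ʳ false b t = t

  _∪_ : Graph U → Graph U → Graph U
  G ∪ H = record
    { V     = λ u → V G u ∨ V H u
    ; E     = λ u v → E G u v ∨ E H u v
    ; E-sym = λ u v → cong₂ _∨_ (E-sym G u v) (E-sym H u v)
    ; E-irr = λ v → cong₂ _∨_ (E-irr G v) (E-irr H v)
    ; E-V   = λ u v e → [ (λ g → T-∨ˡ (V G u) (V H u) (E-V G u v g))
                        , (λ h → T-∨ʳ (V G u) (V H u) (E-V H u v h)) ]′
                        (T-∨ (E G u v) (E H u v) e)
    }

  ShareOnlyEdge : Graph U → Graph U → U → U → Set
  ShareOnlyEdge G H x y =
    (∀ u → (T (V G u) × T (V H u) → u ≡ x ⊎ u ≡ y)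
         × (u ≡ x ⊎ u ≡ y → T (V G u) × T (V H u)))
    × (∀ u v → (T (E G u v) × T (E H u v) →
                  (u ≡ x × v ≡ y) ⊎ (u ≡ y × v ≡ x))
             × ((u ≡ x × v ≡ y) ⊎ (u ≡ y × v ≡ x) →
                  T (E G u v) × T (E H u v)))

module Submission where

-- Write G ≅ T₁ ∘ P₁ with x ↦ (a,1), y ↦ (a,A) and H ≅ T₂ ∘ P₂ with
-- x ↦ (b,1), y ↦ (b,B).  Glue T₁ and T₂ by identifying a with b; at the
-- glued vertex take both neighbourhood partitions side by side, with the
-- parts A and B merged into one (they both stand for y).  The corona of this
-- wedge contains copies of the two coronas meeting exactly in
-- (a,1) = (b,1) and (a,A) = (b,B), with no further edges between them, so it
-- is G ∪ H.  The wedge is again a tree: a cycle passes the glued vertex at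
-- most once, so it never changes sides and lives in T₁ or in T₂.

open import Defs
open import Data.Nat using (ℕ; zero; suc; pred; _+_; _≤_; s≤s; z≤n)
open import Data.Fin using (Fin; zero; suc; punchIn; punchOut; _↑ˡ_; _↑ʳ_; splitAt)
open import Data.Fin.Properties
  using (punchIn-injective; punchInᵢ≢i; punchIn-punchOut; splitAt-↑ˡ; splitAt-↑ʳ;
         splitAt⁻¹-↑ˡ; splitAt⁻¹-↑ʳ; ↑ˡ-injective; ↑ʳ-injective; _≟_)
open import Data.Bool using (Bool; false; T; _∨_)
open import Data.Bool.Properties using (T-irrelevant; T-∨)
open import Data.Unit using (⊤; tt)
open import Data.Maybe as Maybe using (Maybe; just; nothing)
open import Data.List using (List; []; _∷_; _++_; [_]; length; map)
open import Data.List.Properties using (map-++; length-map; ++-assoc)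
open import Data.List.Relation.Unary.Linked as Linked using (Linked; []; [-]; _∷_)
open import Data.List.Relation.Unary.All as All using (All; []; _∷_)
open import Data.List.Relation.Unary.All.Properties as All using (¬Any⇒All¬)
open import Data.List.Relation.Unary.Any using (Any; here; there; any?)
open import Data.List.Relation.Unary.Any.Properties as Any using ()
open import Data.List.Relation.Unary.Unique.Propositional using (Unique; []; _∷_)
open import Data.List.Membership.Propositional.Properties using (∈-∃++)
open import Data.Product using (Σ; ∃; _×_; _,_; proj₁; proj₂)
open import Data.Product.Function.NonDependent.Propositional using (_×-⇔_)
open import Data.Sum using (_⊎_; inj₁; inj₂; [_,_]′)
open import Data.Empty using (⊥; ⊥-elim)
open import Relation.Binary.PropositionalEquality
  using (_≡_; _≢_; refl; sym; trans; cong; cong-app; subst; subst₂; ≢-sym; module ≡-Reasoning)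
open import Relation.Nullary using (¬_; yes; no; Dec)
open import Relation.Nullary.Decidable using (T?)
open import Function.Bundles using (_↔_; _⇔_; Inverse; Equivalence; mk↔ₛ′; mk⇔)
open import Function.Base using (_∘_; case_of_)
open import Function.Construct.Composition using (_↔-∘_; _⇔-∘_)
open import Function.Construct.Symmetry using (↔-sym; ⇔-sym)

punchIn′ : {K : ℕ} → Fin K → Fin (pred K) → Fin K
punchIn′ {suc K} = punchIn

punchIn′≢ : {K : ℕ} (p : Fin K) (j : Fin (pred K)) → punchIn′ p j ≢ p
punchIn′≢ {suc K} = punchInᵢ≢i

punchIn′-injective : {K : ℕ} (p : Fin K) {i j : Fin (pred K)} →
                     punchIn′ p i ≡ punchIn′ p j → i ≡ j
punchIn′-injective {suc K} p = punchIn-injective p _ _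

data PunchView {K : ℕ} (p : Fin K) : Fin K → Set where
  pivot   : PunchView p p
  punched : (j : Fin (pred K)) → PunchView p (punchIn′ p j)

punchView : {K : ℕ} (p u : Fin K) → PunchView p u
punchView {suc K} p u with p ≟ u
... | yes refl = pivot
... | no p≢u   = subst (PunchView p) (punchIn-punchOut p≢u) (punched (punchOut p≢u))

module _ {K : ℕ} (p : Fin K) {P : Fin K → Set}
         (onPivot : P p) (onPunched : ∀ j → P (punchIn′ p j)) where

  punchElimᵛ : ∀ {u} → PunchView p u → P u
  punchElimᵛ pivot       = onPivot
  punchElimᵛ (punched j) = onPunched j

  punchElim : ∀ u → P u
  punchElim u = punchElimᵛ (punchView p u)

  private
    atPivot : ∀ {u} (v : PunchView p u) (e : u ≡ p) → subst P e (punchElimᵛ v) ≡ onPivot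
    atPivot pivot       refl = refl
    atPivot (punched j) e    = ⊥-elim (punchIn′≢ p j e)

    atPunched : ∀ {u} (v : PunchView p u) j (e : u ≡ punchIn′ p j) →
                subst P e (punchElimᵛ v) ≡ onPunched j
    atPunched pivot       j e = ⊥-elim (punchIn′≢ p j (sym e))
    atPunched (punched i) j e with punchIn′-injective p e
    ... | refl with e
    ...   | refl = refl

  punchElim-pivot : punchElim p ≡ onPivot
  punchElim-pivot = atPivot (punchView p p) refl

  punchElim-punched : ∀ j → punchElim (punchIn′ p j) ≡ onPunched j
  punchElim-punched j = atPunched (punchView p (punchIn′ p j)) j refl

data SplitView (m n : ℕ) : Fin (m + n) → Set where
  onˡ : (i : Fin m) → SplitView m n (i ↑ˡ n)
  onʳ : (j : Fin n) → SplitView m n (m ↑ʳ j)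

splitView : (m n : ℕ) (i : Fin (m + n)) → SplitView m n i
splitView m n i with splitAt m i in eq
... | inj₁ j = subst (SplitView m n) (splitAt⁻¹-↑ˡ eq) (onˡ j)
... | inj₂ j = subst (SplitView m n) (splitAt⁻¹-↑ʳ eq) (onʳ j)

↑ˡ≢↑ʳ : ∀ {m n} (i : Fin m) (j : Fin n) → i ↑ˡ n ≢ m ↑ʳ j
↑ˡ≢↑ʳ {m} {n} i j e with trans (sym (splitAt-↑ˡ m i n)) (trans (cong (splitAt m) e) (splitAt-↑ʳ m n j))
... | ()

module _ {n : ℕ} {adj : Fin n → Fin n → Bool} where

  walk-++ : ∀ {u v w} → Walk adj u v → Walk adj v w → Walk adj u w
  walk-++ (here _)         q = q
  walk-++ (step u w v e p) q = step u w _ e (walk-++ p q)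

  walk-reverse : (∀ u v → adj u v ≡ adj v u) → ∀ {u v} → Walk adj u v → Walk adj v u
  walk-reverse adj-sym (here v)         = here v
  walk-reverse adj-sym (step u w v e p) =
    walk-++ (walk-reverse adj-sym p) (step w u u (subst T (adj-sym u w) e) (here u))

walk-map : ∀ {n m} {adj : Fin n → Fin n → Bool} {adj′ : Fin m → Fin m → Bool}
           (f : Fin n → Fin m) → (∀ u v → T (adj u v) → T (adj′ (f u) (f v))) →
           ∀ {u v} → Walk adj u v → Walk adj′ (f u) (f v)
walk-map f f-adj (here v)         = here (f v)
walk-map f f-adj (step u w v e p) = step (f u) (f w) (f v) (f-adj u w e) (walk-map f f-adj p)

CycleIn : {A : Set} → (A → A → Set) → A → List A → Set
CycleIn R v cs = (2 ≤ length cs) × Unique (v ∷ cs) × Linked R (v ∷ cs ++ [ v ])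

module _ {A : Set} {R : A → A → Set} where

  linked-++⁻ˡ : ∀ xs {ys} → Linked R (xs ++ ys) → Linked R xs
  linked-++⁻ˡ []           _       = []
  linked-++⁻ˡ (x ∷ [])     _       = [-]
  linked-++⁻ˡ (x ∷ y ∷ xs) (r ∷ l) = r ∷ linked-++⁻ˡ (y ∷ xs) l

  linked-++⁻ʳ : ∀ xs {ys} → Linked R (xs ++ ys) → Linked R ys
  linked-++⁻ʳ []           l = l
  linked-++⁻ʳ (x ∷ xs)     l = linked-++⁻ʳ xs (Linked.tail l)

  linked-spread : {P Q : A → Set} →
                  (∀ {x y} → Q x → R x y → P x → P y) → (∀ {x y} → R x y → R y x) →
                  ∀ {xs} → Linked R xs → All Q xs → Any P xs → All P xs
  linked-spread pass R-sym [-]      (_ ∷ [])  (here px)   = px ∷ []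
  linked-spread pass R-sym [-]      _         (there ())
  linked-spread pass R-sym (r ∷ lk) (qx ∷ qs) (here px)   =
    px ∷ linked-spread pass R-sym lk qs (here (pass qx r px))
  linked-spread pass R-sym (r ∷ lk) (qx ∷ qs) (there any) =
    pass (All.head qs) (R-sym r) (All.head rest) ∷ rest
    where rest = linked-spread pass R-sym lk qs any

unique-middle : {A : Set} (p : List A) {z : A} {q : List A} →
                Unique (p ++ z ∷ q) → All (z ≢_) p × All (z ≢_) q
unique-middle []      (z∉q ∷ _) = [] , z∉q
unique-middle (x ∷ p) (x∉ ∷ u)  =
  ≢-sym (All.head (All.++⁻ʳ p x∉)) ∷ proj₁ (unique-middle p u) , proj₂ (unique-middle p u)

module _ {A B : Set} {R : A → A → Set} {S : B → B → Set} {P : A → Set} (f : A → B)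
         (f-hom : ∀ {x y} → P x → P y → R x y → S (f x) (f y))
         (f-inj : ∀ {x y} → P x → P y → f x ≡ f y → x ≡ y) where

  private
    linked-map : ∀ {xs} → All P xs → Linked R xs → Linked S (map f xs)
    linked-map []             []       = []
    linked-map (_ ∷ [])       [-]      = [-]
    linked-map (px ∷ py ∷ ps) (r ∷ lk) = f-hom px py r ∷ linked-map (py ∷ ps) lk

    ≢-map : ∀ {x xs} → P x → All P xs → All (x ≢_) xs → All (f x ≢_) (map f xs)
    ≢-map px []        []          = []
    ≢-map px (py ∷ ps) (x≢y ∷ x∉) = (λ e → x≢y (f-inj px py e)) ∷ ≢-map px ps x∉

    unique-map : ∀ {xs} → All P xs → Unique xs → Unique (map f xs)
    unique-map []        []         = []
    unique-map (px ∷ ps) (x∉ ∷ uq) = ≢-map px ps x∉ ∷ unique-map ps uq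

  cycle-map : ∀ {v cs} → All P (v ∷ cs) → CycleIn R v cs → CycleIn S (f v) (map f cs)
  cycle-map {v} {cs} (pv ∷ pcs) (len , uq , lk) =
      subst (2 ≤_) (sym (length-map f cs)) len
    , unique-map (pv ∷ pcs) uq
    , subst (λ L → Linked S (f v ∷ L)) (map-++ f cs [ v ])
            (linked-map (pv ∷ All.++⁺ pcs (pv ∷ [])) lk)

-- The wedge of two trees

data Side : Set where
  left right : Side

module Wedge (T₁ T₂ : Tree) (a : Fin (Tree.n T₁)) (b : Fin (Tree.n T₂)) where
  open Tree T₁ using () renaming (n to n₁; adj to adj₁; adj-sym to adj₁-sym; adj-irr to adj₁-irr)
  open Tree T₂ using () renaming (n to n₂; adj to adj₂; adj-sym to adj₂-sym; adj-irr to adj₂-irr)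

  data Vertex : Set where
    hub : Vertex
    inˡ : Fin (pred n₁) → Vertex
    inʳ : Fin (pred n₂) → Vertex

  Adj : Vertex → Vertex → Bool
  Adj hub     hub     = false
  Adj hub     (inˡ j) = adj₁ a (punchIn′ a j)
  Adj hub     (inʳ j) = adj₂ b (punchIn′ b j)
  Adj (inˡ i) hub     = adj₁ (punchIn′ a i) a
  Adj (inˡ i) (inˡ j) = adj₁ (punchIn′ a i) (punchIn′ a j)
  Adj (inˡ i) (inʳ j) = false
  Adj (inʳ i) hub     = adj₂ (punchIn′ b i) b
  Adj (inʳ i) (inˡ j) = false
  Adj (inʳ i) (inʳ j) = adj₂ (punchIn′ b i) (punchIn′ b j)

  Adj-sym : ∀ u v → Adj u v ≡ Adj v u
  Adj-sym hub     hub     = refl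
  Adj-sym hub     (inˡ j) = adj₁-sym _ _
  Adj-sym hub     (inʳ j) = adj₂-sym _ _
  Adj-sym (inˡ i) hub     = adj₁-sym _ _
  Adj-sym (inˡ i) (inˡ j) = adj₁-sym _ _
  Adj-sym (inˡ i) (inʳ j) = refl
  Adj-sym (inʳ i) hub     = adj₂-sym _ _
  Adj-sym (inʳ i) (inˡ j) = refl
  Adj-sym (inʳ i) (inʳ j) = adj₂-sym _ _

  Adj-irr : ∀ v → Adj v v ≡ false
  Adj-irr hub     = refl
  Adj-irr (inˡ i) = adj₁-irr _
  Adj-irr (inʳ i) = adj₂-irr _

  Edge : Vertex → Vertex → Set
  Edge u v = T (Adj u v)

  Edge-sym : ∀ {u v} → Edge u v → Edge v u
  Edge-sym {u} {v} = subst T (Adj-sym u v)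

  ¬loop₁ : ¬ T (adj₁ a a)
  ¬loop₁ = subst T (adj₁-irr a)

  ¬loop₂ : ¬ T (adj₂ b b)
  ¬loop₂ = subst T (adj₂-irr b)

  ι₁ : Fin n₁ → Vertex
  ι₁ = punchElim a hub inˡ

  ι₂ : Fin n₂ → Vertex
  ι₂ = punchElim b hub inʳ

  ι₁-injective : ∀ {u v} → ι₁ u ≡ ι₁ v → u ≡ v
  ι₁-injective {u} {v} e with punchView a u | punchView a v
  ... | pivot     | pivot     = refl
  ... | pivot     | punched j = case e of λ ()
  ... | punched i | pivot     = case e of λ ()
  ... | punched i | punched j = cong (punchIn′ a) (inˡ-injective e)
    where inˡ-injective : ∀ {i j} → inˡ i ≡ inˡ j → i ≡ j
          inˡ-injective refl = refl

  ι₂-injective : ∀ {u v} → ι₂ u ≡ ι₂ v → u ≡ v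
  ι₂-injective {u} {v} e with punchView b u | punchView b v
  ... | pivot     | pivot     = refl
  ... | pivot     | punched j = case e of λ ()
  ... | punched i | pivot     = case e of λ ()
  ... | punched i | punched j = cong (punchIn′ b) (inʳ-injective e)
    where inʳ-injective : ∀ {i j} → inʳ i ≡ inʳ j → i ≡ j
          inʳ-injective refl = refl

  ι₁-edge : ∀ u v → T (adj₁ u v) ⇔ Edge (ι₁ u) (ι₁ v)
  ι₁-edge u v with punchView a u | punchView a v
  ... | pivot     | pivot     = mk⇔ (λ e → ⊥-elim (¬loop₁ e)) (λ ())
  ... | pivot     | punched j = mk⇔ (λ e → e) (λ e → e)
  ... | punched i | pivot     = mk⇔ (λ e → e) (λ e → e)
  ... | punched i | punched j = mk⇔ (λ e → e) (λ e → e)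

  ι₂-edge : ∀ u v → T (adj₂ u v) ⇔ Edge (ι₂ u) (ι₂ v)
  ι₂-edge u v with punchView b u | punchView b v
  ... | pivot     | pivot     = mk⇔ (λ e → ⊥-elim (¬loop₂ e)) (λ ())
  ... | pivot     | punched j = mk⇔ (λ e → e) (λ e → e)
  ... | punched i | pivot     = mk⇔ (λ e → e) (λ e → e)
  ... | punched i | punched j = mk⇔ (λ e → e) (λ e → e)

  OnSide : Side → Vertex → Set
  OnSide _     hub     = ⊤
  OnSide left  (inˡ _) = ⊤
  OnSide left  (inʳ _) = ⊥
  OnSide right (inˡ _) = ⊥
  OnSide right (inʳ _) = ⊤

  onSide-step : ∀ {s u v} → hub ≢ u → Edge u v → OnSide s u → OnSide s v
  onSide-step {u = hub}                 hub≢u = ⊥-elim (hub≢u refl)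
  onSide-step {left}  {inˡ i} {hub}     _ _ _ = tt
  onSide-step {left}  {inˡ i} {inˡ j}   _ _ _ = tt
  onSide-step {left}  {inʳ i} {v}       _ _ ()
  onSide-step {right} {inˡ i} {v}       _ _ ()
  onSide-step {right} {inʳ i} {hub}     _ _ _ = tt
  onSide-step {right} {inʳ i} {inʳ j}   _ _ _ = tt

  sideOf : ∀ v → hub ≢ v → ∃ λ s → OnSide s v
  sideOf hub     hub≢v = ⊥-elim (hub≢v refl)
  sideOf (inˡ _) _     = left , tt
  sideOf (inʳ _) _     = right , tt

  spread : ∀ {s xs} → Linked Edge xs → All (hub ≢_) xs → Any (OnSide s) xs → All (OnSide s) xs
  spread = linked-spread onSide-step (λ {u} {v} → Edge-sym {u} {v})

  hub? : ∀ v → Dec (hub ≡ v)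
  hub? hub     = yes refl
  hub? (inˡ _) = no λ ()
  hub? (inʳ _) = no λ ()

  -- The hub occurs at most once on a cycle, so the cycle minus the hub is a
  -- single stretch of edges between non-hub vertices, which never changes side.
  one-sided-off-hub : ∀ {v cs} → hub ≢ v → CycleIn Edge v cs → ∃ λ s → All (OnSide s) (v ∷ cs)
  one-sided-off-hub {v} {cs} hub≢v (_ , _ ∷ uq , lk) with sideOf v hub≢v | any? hub? cs
  ... | s , sv | no hub∉cs =
    s , spread (linked-++⁻ˡ (v ∷ cs) lk) (hub≢v ∷ ¬Any⇒All¬ cs hub∉cs) (here sv)
  ... | s , sv | yes hub∈cs with ∈-∃++ hub∈cs
  ...   | p , q , refl = s , All.++⁺ before (tt ∷ All.++⁻ˡ q after)
    where
    lk′ : Linked Edge (v ∷ p ++ hub ∷ q ++ [ v ])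
    lk′ = subst (λ L → Linked Edge (v ∷ L)) (++-assoc p (hub ∷ q) [ v ]) lk
    hub∉ : All (hub ≢_) p × All (hub ≢_) q
    hub∉ = unique-middle p uq
    before : All (OnSide s) (v ∷ p)
    before = spread (linked-++⁻ˡ (v ∷ p) lk′) (hub≢v ∷ proj₁ hub∉) (here sv)
    after : All (OnSide s) (q ++ [ v ])
    after = spread (Linked.tail (linked-++⁻ʳ (v ∷ p) lk′))
                   (All.++⁺ (proj₂ hub∉) (hub≢v ∷ [])) (Any.++⁺ʳ q (here sv))

  cycle-one-sided : ∀ {v cs} → CycleIn Edge v cs → ∃ λ s → All (OnSide s) (v ∷ cs)
  cycle-one-sided {hub} {[]}     _                                = left , tt ∷ []
  cycle-one-sided {hub} {h ∷ hs} (_ , (hub≢h ∷ hub∉hs) ∷ _ , _ ∷ lk) with sideOf h hub≢h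
  ... | s , sh = s , tt ∷ spread (linked-++⁻ˡ (h ∷ hs) lk) (hub≢h ∷ hub∉hs) (here sh)
  cycle-one-sided {inˡ i} = one-sided-off-hub (λ ())
  cycle-one-sided {inʳ i} = one-sided-off-hub (λ ())

  treeOf : Side → Tree
  treeOf left  = T₁
  treeOf right = T₂

  retract : (s : Side) → Vertex → Fin (Tree.n (treeOf s))
  retract left  hub     = a
  retract left  (inˡ j) = punchIn′ a j
  retract left  (inʳ _) = a
  retract right hub     = b
  retract right (inˡ _) = b
  retract right (inʳ j) = punchIn′ b j

  retract-edge : ∀ {s u v} → OnSide s u → OnSide s v → Edge u v →
                 T (Tree.adj (treeOf s) (retract s u) (retract s v))
  retract-edge {_}     {hub}   {hub}   _  _  ()
  retract-edge {left}  {hub}   {inˡ j} _  _  e = e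
  retract-edge {left}  {inˡ i} {hub}   _  _  e = e
  retract-edge {left}  {inˡ i} {inˡ j} _  _  e = e
  retract-edge {right} {hub}   {inʳ j} _  _  e = e
  retract-edge {right} {inʳ i} {hub}   _  _  e = e
  retract-edge {right} {inʳ i} {inʳ j} _  _  e = e
  retract-edge {left}  {inʳ _}         () _  _
  retract-edge {left}  {_}     {inʳ _} _  () _
  retract-edge {right} {inˡ _}         () _  _
  retract-edge {right} {_}     {inˡ _} _  () _

  retract-injective : ∀ {s u v} → OnSide s u → OnSide s v → retract s u ≡ retract s v → u ≡ v
  retract-injective {_}     {hub}   {hub}   _  _  _ = refl
  retract-injective {left}  {hub}   {inˡ j} _  _  e = ⊥-elim (punchIn′≢ a j (sym e))
  retract-injective {left}  {inˡ i} {hub}   _  _  e = ⊥-elim (punchIn′≢ a i e)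
  retract-injective {left}  {inˡ i} {inˡ j} _  _  e = cong inˡ (punchIn′-injective a e)
  retract-injective {right} {hub}   {inʳ j} _  _  e = ⊥-elim (punchIn′≢ b j (sym e))
  retract-injective {right} {inʳ i} {hub}   _  _  e = ⊥-elim (punchIn′≢ b i e)
  retract-injective {right} {inʳ i} {inʳ j} _  _  e = cong inʳ (punchIn′-injective b e)
  retract-injective {left}  {inʳ _}         () _  _
  retract-injective {left}  {_}     {inʳ _} _  () _
  retract-injective {right} {inˡ _}         () _  _
  retract-injective {right} {_}     {inˡ _} _  () _

  acyclic-Edge : ∀ v cs → ¬ CycleIn Edge v cs
  acyclic-Edge v cs cycle with cycle-one-sided cycle
  ... | s , sides =
    Tree.acyclic (treeOf s) _ _ (cycle-map (retract s) retract-edge retract-injective sides cycle)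

  size : ℕ
  size = suc (pred n₁ + pred n₂)

  fromFin : Fin size → Vertex
  fromFin zero    = hub
  fromFin (suc i) = [ inˡ , inʳ ]′ (splitAt (pred n₁) i)

  toFin : Vertex → Fin size
  toFin hub     = zero
  toFin (inˡ j) = suc (j ↑ˡ pred n₂)
  toFin (inʳ j) = suc (pred n₁ ↑ʳ j)

  fromFin-toFin : ∀ v → fromFin (toFin v) ≡ v
  fromFin-toFin hub     = refl
  fromFin-toFin (inˡ j) rewrite splitAt-↑ˡ (pred n₁) j (pred n₂) = refl
  fromFin-toFin (inʳ j) rewrite splitAt-↑ʳ (pred n₁) (pred n₂) j = refl

  toFin-fromFin : ∀ i → toFin (fromFin i) ≡ i
  toFin-fromFin zero    = refl
  toFin-fromFin (suc i) with splitView (pred n₁) (pred n₂) i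
  ... | onˡ j rewrite splitAt-↑ˡ (pred n₁) j (pred n₂) = refl
  ... | onʳ j rewrite splitAt-↑ʳ (pred n₁) (pred n₂) j = refl

  fromFin-injective : ∀ {i j} → fromFin i ≡ fromFin j → i ≡ j
  fromFin-injective {i} {j} e = trans (sym (toFin-fromFin i)) (trans (cong toFin e) (toFin-fromFin j))

  adjFin : Fin size → Fin size → Bool
  adjFin i j = Adj (fromFin i) (fromFin j)

  toFin-edge : ∀ {u v} → Edge u v → T (adjFin (toFin u) (toFin v))
  toFin-edge {u} {v} = subst₂ Edge (sym (fromFin-toFin u)) (sym (fromFin-toFin v))

  walk-to-hub : ∀ v → Walk adjFin (toFin v) zero
  walk-to-hub hub     = here zero
  walk-to-hub (inˡ j) =
    subst₂ (λ u w → Walk adjFin (toFin u) (toFin w))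
           (punchElim-punched a hub inˡ j) (punchElim-pivot a hub inˡ)
           (walk-map (toFin ∘ ι₁) (λ u v e → toFin-edge {ι₁ u} {ι₁ v} (Equivalence.to (ι₁-edge u v) e))
                     (Tree.connected T₁ (punchIn′ a j) a))
  walk-to-hub (inʳ j) =
    subst₂ (λ u w → Walk adjFin (toFin u) (toFin w))
           (punchElim-punched b hub inʳ j) (punchElim-pivot b hub inʳ)
           (walk-map (toFin ∘ ι₂) (λ u v e → toFin-edge {ι₂ u} {ι₂ v} (Equivalence.to (ι₂-edge u v) e))
                     (Tree.connected T₂ (punchIn′ b j) b))

  connected : Connected adjFin
  connected i j = walk-++ (toHub i) (walk-reverse (λ u v → Adj-sym (fromFin u) (fromFin v)) (toHub j))
    where
    toHub : ∀ i → Walk adjFin i zero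
    toHub i = subst (λ w → Walk adjFin w zero) (toFin-fromFin i) (walk-to-hub (fromFin i))

  acyclic : Acyclic adjFin
  acyclic v cs cycle =
    acyclic-Edge (fromFin v) (map fromFin cs)
      (cycle-map {P = λ _ → ⊤} fromFin (λ _ _ e → e) (λ _ _ → fromFin-injective)
                 (All.universal (λ _ → tt) (v ∷ cs)) cycle)

  wedge : Tree
  wedge = record
    { n         = size
    ; adj       = adjFin
    ; adj-sym   = λ u v → Adj-sym (fromFin u) (fromFin v)
    ; adj-irr   = λ v → Adj-irr (fromFin v)
    ; nonempty  = s≤s z≤n
    ; connected = connected
    ; acyclic   = acyclic
    }

-- The wedge of two general coronas: at the hub, the parts of P₂(b) other
-- than B are appended to those of P₁(a), and B is merged into A.

module WedgeCorona (T₁ : Tree) (P₁ : NbPartition T₁) (T₂ : Tree) (P₂ : NbPartition T₂)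
                   (a : Fin (Tree.n T₁)) (b : Fin (Tree.n T₂))
                   (A : Fin (NbPartition.k P₁ a)) (B : Fin (NbPartition.k P₂ b)) where
  open Wedge T₁ T₂ a b public
  open Tree T₁ using () renaming (adj to adj₁)
  open Tree T₂ using () renaming (adj to adj₂)
  open NbPartition P₁ using () renaming (k to k₁; part to part₁; surj to surj₁)
  open NbPartition P₂ using () renaming (k to k₂; part to part₂; surj to surj₂)

  K′ : ℕ
  K′ = pred (k₂ b)

  mergeˡ : Fin (k₁ a) → Fin (k₁ a + K′)
  mergeˡ C = C ↑ˡ K′

  mergeʳ : Fin (k₂ b) → Fin (k₁ a + K′)
  mergeʳ = punchElim B (A ↑ˡ K′) (k₁ a ↑ʳ_)

  mergeʳ-pivot : mergeʳ B ≡ mergeˡ A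
  mergeʳ-pivot = punchElim-pivot B (A ↑ˡ K′) (k₁ a ↑ʳ_)

  mergeʳ-punched : ∀ j → mergeʳ (punchIn′ B j) ≡ k₁ a ↑ʳ j
  mergeʳ-punched = punchElim-punched B (A ↑ˡ K′) (k₁ a ↑ʳ_)

  mergeʳ-injective : ∀ {C D} → mergeʳ C ≡ mergeʳ D → C ≡ D
  mergeʳ-injective {C} {D} e with punchView B C | punchView B D
  ... | pivot     | pivot     = refl
  ... | pivot     | punched j = ⊥-elim (↑ˡ≢↑ʳ A j e)
  ... | punched i | pivot     = ⊥-elim (↑ˡ≢↑ʳ A i (sym e))
  ... | punched i | punched j = cong (punchIn′ B) (↑ʳ-injective (k₁ a) i j e)

  mergeʳ≡mergeˡ : ∀ D C → mergeʳ D ≡ mergeˡ C → D ≡ B × C ≡ A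
  mergeʳ≡mergeˡ D C e with punchView B D
  ... | pivot     = refl , sym (↑ˡ-injective K′ A C e)
  ... | punched j = ⊥-elim (↑ˡ≢↑ʳ C j (sym e))

  parts : Vertex → ℕ
  parts hub     = k₁ a + K′
  parts (inˡ j) = k₁ (punchIn′ a j)
  parts (inʳ j) = k₂ (punchIn′ b j)

  part : (u v : Vertex) → Edge u v → Fin (parts u)
  part hub     (inˡ j) p = mergeˡ (part₁ a (punchIn′ a j) p)
  part hub     (inʳ j) p = mergeʳ (part₂ b (punchIn′ b j) p)
  part (inˡ i) hub     p = part₁ (punchIn′ a i) a p
  part (inˡ i) (inˡ j) p = part₁ (punchIn′ a i) (punchIn′ a j) p
  part (inʳ i) hub     p = part₂ (punchIn′ b i) b p
  part (inʳ i) (inʳ j) p = part₂ (punchIn′ b i) (punchIn′ b j) p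

  InPart : (u : Vertex) → Fin (parts u) → Set
  InPart u C = ∃ λ v → Σ (Edge u v) λ p → part u v p ≡ C

  part-surjective : ∀ u C → InPart u C
  part-surjective (inˡ i) C with surj₁ (punchIn′ a i) C
  ... | u , p , e with punchView a u
  ...   | pivot     = hub , p , e
  ...   | punched j = inˡ j , p , e
  part-surjective (inʳ i) C with surj₂ (punchIn′ b i) C
  ... | u , p , e with punchView b u
  ...   | pivot     = hub , p , e
  ...   | punched j = inʳ j , p , e
  part-surjective hub C with splitView (k₁ a) K′ C
  ... | onˡ C₁ = fromLeft (surj₁ a C₁)
    where
    fromLeft : (∃ λ u → Σ (T (adj₁ a u)) λ p → part₁ a u p ≡ C₁) → InPart hub (mergeˡ C₁)
    fromLeft (u , p , e) with punchView a u
    ... | pivot     = ⊥-elim (¬loop₁ p)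
    ... | punched j = inˡ j , p , cong mergeˡ e
  ... | onʳ C₂ = fromRight (surj₂ b (punchIn′ B C₂))
    where
    fromRight : (∃ λ u → Σ (T (adj₂ b u)) λ p → part₂ b u p ≡ punchIn′ B C₂) →
                InPart hub (k₁ a ↑ʳ C₂)
    fromRight (u , p , e) with punchView b u
    ... | pivot     = ⊥-elim (¬loop₂ p)
    ... | punched j = inʳ j , p , trans (cong mergeʳ e) (mergeʳ-punched C₂)

  part-irrelevant : ∀ u {v w} (e : v ≡ w) p q → part u v p ≡ part u w q
  part-irrelevant u refl p q = cong (part u _) (T-irrelevant p q)

  wedgePartition : NbPartition wedge
  wedgePartition = record
    { k    = λ i → parts (fromFin i)
    ; part = λ i j p → part (fromFin i) (fromFin j) p
    ; surj = λ i C → let (v , p , e) = part-surjective (fromFin i) C in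
        toFin v , subst (Edge (fromFin i)) (sym (fromFin-toFin v)) p
                , trans (part-irrelevant (fromFin i) (fromFin-toFin v) _ p) e
    }

  CVertex : Set
  CVertex = Σ Vertex λ v → Maybe (Fin (parts v))

  CEdge : CVertex → CVertex → Set
  CEdge (u , nothing) (v , nothing) = ⊥
  CEdge (u , nothing) (v , just _)  = u ≡ v
  CEdge (u , just _)  (v , nothing) = u ≡ v
  CEdge (u , just C)  (v , just D)  =
    (Σ (Edge u v) λ p → part u v p ≡ C) × (Σ (Edge v u) λ q → part v u q ≡ D)

  CEdge-sym : ∀ g h → CEdge g h → CEdge h g
  CEdge-sym (u , nothing) (v , nothing) ()
  CEdge-sym (u , nothing) (v , just _)  e       = sym e
  CEdge-sym (u , just _)  (v , nothing) e       = sym e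
  CEdge-sym (u , just _)  (v , just _)  (p , q) = q , p

  enumerate : CVtx wedge wedgePartition ↔ CVertex
  enumerate = mk↔ₛ′ (λ (i , m) → fromFin i , m) fromVertex to∘from from∘to
    where
    fromVertex : CVertex → CVtx wedge wedgePartition
    fromVertex (v , m) = toFin v , subst (λ w → Maybe (Fin (parts w))) (sym (fromFin-toFin v)) m

    to∘from : ∀ g → (fromFin (proj₁ (fromVertex g)) , proj₂ (fromVertex g)) ≡ g
    to∘from (v , m) = subst-pair (fromFin-toFin v) m
      where
      subst-pair : ∀ {w} (e : w ≡ v) m → (w , subst (λ z → Maybe (Fin (parts z))) (sym e) m) ≡ (v , m)
      subst-pair refl m = refl

    from∘to : ∀ g → fromVertex (fromFin (proj₁ g) , proj₂ g) ≡ g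
    from∘to (i , m) = subst-pair (toFin-fromFin i) (fromFin-toFin (fromFin i)) m
      where
      subst-pair : ∀ {j} (e : j ≡ i) (e′ : fromFin j ≡ fromFin i) m →
              _≡_ {A = CVtx wedge wedgePartition} (j , subst (λ z → Maybe (Fin (parts z))) (sym e′) m) (i , m)
      subst-pair refl refl m = refl

  private
    CAdj⇔CEdge : ∀ g h → CAdj wedge wedgePartition g h ⇔ CEdge (Inverse.to enumerate g) (Inverse.to enumerate h)
    CAdj⇔CEdge (i , nothing) (j , nothing) = mk⇔ (λ ()) (λ ())
    CAdj⇔CEdge (i , nothing) (j , just _)  = mk⇔ (cong fromFin) fromFin-injective
    CAdj⇔CEdge (i , just _)  (j , nothing) = mk⇔ (cong fromFin) fromFin-injective
    CAdj⇔CEdge (i , just _)  (j , just _)  = mk⇔ (λ z → z) (λ z → z)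

  CEdge⇔CAdj : ∀ g h → CEdge g h
                      ⇔ CAdj wedge wedgePartition (Inverse.from enumerate g) (Inverse.from enumerate h)
  CEdge⇔CAdj g h =
    subst₂ (λ g′ h′ → CEdge g′ h′ ⇔ CAdj wedge wedgePartition (from g) (from h))
           (strictlyInverseˡ g) (strictlyInverseˡ h) (⇔-sym (CAdj⇔CEdge _ _))
    where open Inverse enumerate using (from; strictlyInverseˡ)

  module CoronaEmbedding (Tr : Tree) (P : NbPartition Tr) (ι : Fin (Tree.n Tr) → Vertex)
           (ι-injective : ∀ {u v} → ι u ≡ ι v → u ≡ v)
           (ι-edge : ∀ u v → T (Tree.adj Tr u v) ⇔ Edge (ι u) (ι v))
           (relabel : ∀ u → Fin (NbPartition.k P u) → Fin (parts (ι u)))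
           (relabel-injective : ∀ u {C D} → relabel u C ≡ relabel u D → C ≡ D)
           (part-ι : ∀ u v p → part (ι u) (ι v) (Equivalence.to (ι-edge u v) p)
                               ≡ relabel u (NbPartition.part P u v p)) where

    κ : CVtx Tr P → CVertex
    κ (u , m) = ι u , Maybe.map (relabel u) m

    private
      inPart⇔ : ∀ u v C → (Σ (T (Tree.adj Tr u v)) λ p → NbPartition.part P u v p ≡ C)
                        ⇔ (Σ (Edge (ι u) (ι v)) λ p → part (ι u) (ι v) p ≡ relabel u C)
      inPart⇔ u v C = mk⇔
        (λ (p , e) → to p , trans (part-ι u v p) (cong (relabel u) e))
        (λ (p , e) → from p , relabel-injective u
           (trans (sym (part-ι u v (from p))) (trans (part-irrelevant (ι u) refl _ p) e)))
        where open Equivalence (ι-edge u v)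

    κ-adj : ∀ g h → CAdj Tr P g h ⇔ CEdge (κ g) (κ h)
    κ-adj (u , nothing) (v , nothing) = mk⇔ (λ ()) (λ ())
    κ-adj (u , nothing) (v , just _)  = mk⇔ (cong ι) ι-injective
    κ-adj (u , just _)  (v , nothing) = mk⇔ (cong ι) ι-injective
    κ-adj (u , just C)  (v , just D)  = inPart⇔ u v C ×-⇔ inPart⇔ v u D

  relabel₁ : ∀ u → Fin (k₁ u) → Fin (parts (ι₁ u))
  relabel₁ u with punchView a u
  ... | pivot     = mergeˡ
  ... | punched j = λ C → C

  relabel₂ : ∀ u → Fin (k₂ u) → Fin (parts (ι₂ u))
  relabel₂ u with punchView b u
  ... | pivot     = mergeʳ
  ... | punched j = λ C → C

  relabel₁-injective : ∀ u {C D} → relabel₁ u C ≡ relabel₁ u D → C ≡ D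
  relabel₁-injective u with punchView a u
  ... | pivot     = ↑ˡ-injective K′ _ _
  ... | punched j = λ e → e

  relabel₂-injective : ∀ u {C D} → relabel₂ u C ≡ relabel₂ u D → C ≡ D
  relabel₂-injective u with punchView b u
  ... | pivot     = mergeʳ-injective
  ... | punched j = λ e → e

  part-ι₁ : ∀ u v p → part (ι₁ u) (ι₁ v) (Equivalence.to (ι₁-edge u v) p) ≡ relabel₁ u (part₁ u v p)
  part-ι₁ u v p with punchView a u | punchView a v
  ... | pivot     | pivot     = ⊥-elim (¬loop₁ p)
  ... | pivot     | punched j = refl
  ... | punched i | pivot     = refl
  ... | punched i | punched j = refl

  part-ι₂ : ∀ u v p → part (ι₂ u) (ι₂ v) (Equivalence.to (ι₂-edge u v) p) ≡ relabel₂ u (part₂ u v p)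
  part-ι₂ u v p with punchView b u | punchView b v
  ... | pivot     | pivot     = ⊥-elim (¬loop₂ p)
  ... | pivot     | punched j = refl
  ... | punched i | pivot     = refl
  ... | punched i | punched j = refl

  open CoronaEmbedding T₁ P₁ ι₁ ι₁-injective ι₁-edge relabel₁ relabel₁-injective part-ι₁
    public renaming (κ to κ₁; κ-adj to κ₁-adj)
  open CoronaEmbedding T₂ P₂ ι₂ ι₂-injective ι₂-edge relabel₂ relabel₂-injective part-ι₂
    public renaming (κ to κ₂; κ-adj to κ₂-adj)

  private
    κ₁-by-cases : ∀ u m → κ₁ (u , m) ≡ punchElim a {λ u → Maybe (Fin (k₁ u)) → CVertex}
                                          (λ m → hub , Maybe.map mergeˡ m) (λ j m → inˡ j , m) u m
    κ₁-by-cases u m with punchView a u | m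
    ... | pivot     | _       = refl
    ... | punched j | nothing = refl
    ... | punched j | just _  = refl

    κ₂-by-cases : ∀ u m → κ₂ (u , m) ≡ punchElim b {λ u → Maybe (Fin (k₂ u)) → CVertex}
                                          (λ m → hub , Maybe.map mergeʳ m) (λ j m → inʳ j , m) u m
    κ₂-by-cases u m with punchView b u | m
    ... | pivot     | _       = refl
    ... | punched j | nothing = refl
    ... | punched j | just _  = refl

  κ₁-pivot : ∀ m → κ₁ (a , m) ≡ (hub , Maybe.map mergeˡ m)
  κ₁-pivot m = trans (κ₁-by-cases a m) (cong-app (punchElim-pivot a _ _) m)

  κ₁-punched : ∀ j m → κ₁ (punchIn′ a j , m) ≡ (inˡ j , m)
  κ₁-punched j m = trans (κ₁-by-cases _ m) (cong-app (punchElim-punched a _ _ j) m)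

  κ₂-pivot : ∀ m → κ₂ (b , m) ≡ (hub , Maybe.map mergeʳ m)
  κ₂-pivot m = trans (κ₂-by-cases b m) (cong-app (punchElim-pivot b _ _) m)

  κ₂-punched : ∀ j m → κ₂ (punchIn′ b j , m) ≡ (inʳ j , m)
  κ₂-punched j m = trans (κ₂-by-cases _ m) (cong-app (punchElim-punched b _ _ j) m)

  κ-cross : ∀ g h → h ≢ (b , nothing) → h ≢ (b , just B) → CEdge (κ₁ g) (κ₂ h) →
            (g ≡ (a , nothing) × CAdj T₂ P₂ (b , nothing) h)
            ⊎ (g ≡ (a , just A) × CAdj T₂ P₂ (b , just B) h)
  κ-cross (u , m) (v , m′) h≢x h≢y e with punchView a u | punchView b v
  κ-cross (u , m)        (v , nothing)  h≢x h≢y e | pivot | pivot = ⊥-elim (h≢x refl)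
  κ-cross (u , nothing)  (v , just _)   h≢x h≢y e | pivot | pivot = inj₁ (refl , refl)
  κ-cross (u , just _)   (v , just _)   h≢x h≢y ((() , _) , _) | pivot | pivot
  κ-cross (u , nothing)  (v , nothing)  h≢x h≢y () | pivot | punched j
  κ-cross (u , nothing)  (v , just _)   h≢x h≢y () | pivot | punched j
  κ-cross (u , just _)   (v , nothing)  h≢x h≢y () | pivot | punched j
  κ-cross (u , just C)   (v , just _)   h≢x h≢y ((p , e) , q) | pivot | punched j
    with mergeʳ≡mergeˡ _ C e
  ... | e′ , refl = inj₂ (refl , (p , e′) , q)
  κ-cross (u , m)        (v , nothing)  h≢x h≢y e | punched i | pivot = ⊥-elim (h≢x refl)
  κ-cross (u , nothing)  (v , just _)   h≢x h≢y () | punched i | pivot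
  κ-cross (u , just _)   (v , just D)   h≢x h≢y (_ , q , e) | punched i | pivot =
    ⊥-elim (h≢y (cong (λ D → b , just D) (proj₁ (mergeʳ≡mergeˡ D _ (sym e)))))
  κ-cross (u , nothing)  (v , nothing)  h≢x h≢y () | punched i | punched j
  κ-cross (u , nothing)  (v , just _)   h≢x h≢y () | punched i | punched j
  κ-cross (u , just _)   (v , nothing)  h≢x h≢y () | punched i | punched j
  κ-cross (u , just _)   (v , just _)   h≢x h≢y ((() , _) , _) | punched i | punched j

-- The union of two coronas sharing the edge xy, with x external in both

external-neighbour : ∀ {Tr P} (g h : CVtx Tr P) → IsExternal {Tr} {P} g → CAdj Tr P g h →
                     Σ (Fin (NbPartition.k P (proj₁ g))) λ A → h ≡ (proj₁ g , just A)
external-neighbour (a , nothing) (.a , just A) refl refl = A , refl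

vertex-≡ : ∀ {U : Set} {V : U → Bool} {p q : Σ U λ u → T (V u)} → proj₁ p ≡ proj₁ q → p ≡ q
vertex-≡ {p = u , p} {.u , q} refl = cong (u ,_) (T-irrelevant p q)

edge-endpoints : ∀ {U : Set} (Γ : Graph U) {u w} → T (Graph.E Γ u w) → T (Graph.V Γ u) × T (Graph.V Γ w)
edge-endpoints Γ {u} {w} e = E-V u w e , E-V w u (subst T (E-sym u w) e)
  where open Graph Γ

module Union {U : Set} (G H : Graph U) (x y : U) (shared : ShareOnlyEdge G H x y)
  (T₁ : Tree) (P₁ : NbPartition T₁) (φ₁ : Vtx G ↔ CVtx T₁ P₁) (iso₁ : IsIso G T₁ P₁ φ₁)
  (ext₁ : ∀ (px : T (Graph.V G x)) → IsExternal {T₁} {P₁} (Inverse.to φ₁ (x , px)))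
  (T₂ : Tree) (P₂ : NbPartition T₂) (φ₂ : Vtx H ↔ CVtx T₂ P₂) (iso₂ : IsIso H T₂ P₂ φ₂)
  (ext₂ : ∀ (px : T (Graph.V H x)) → IsExternal {T₂} {P₂} (Inverse.to φ₂ (x , px))) where

  open Graph G using () renaming (V to V₁; E to E₁)
  open Graph H using () renaming (V to V₂; E to E₂)
  open Inverse φ₁ using ()
    renaming (to to to₁; from to from₁; strictlyInverseˡ to to₁∘from₁; strictlyInverseʳ to from₁∘to₁)
  open Inverse φ₂ using ()
    renaming (to to to₂; from to from₂; strictlyInverseˡ to to₂∘from₂; strictlyInverseʳ to from₂∘to₂)

  open NbPartition P₁ using () renaming (k to k₁)

  x∈G : T (V₁ x)
  x∈G = proj₁ (proj₂ (proj₁ shared x) (inj₁ refl))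
  x∈H : T (V₂ x)
  x∈H = proj₂ (proj₂ (proj₁ shared x) (inj₁ refl))
  y∈G : T (V₁ y)
  y∈G = proj₁ (proj₂ (proj₁ shared y) (inj₂ refl))
  y∈H : T (V₂ y)
  y∈H = proj₂ (proj₂ (proj₁ shared y) (inj₂ refl))

  xy∈G×H : T (E₁ x y) × T (E₂ x y)
  xy∈G×H = proj₂ (proj₂ shared x y) (inj₁ (refl , refl))

  a : Fin (Tree.n T₁)
  a = proj₁ (to₁ (x , x∈G))
  b : Fin (Tree.n T₂)
  b = proj₁ (to₂ (x , x∈H))

  x↦₁ : to₁ (x , x∈G) ≡ (a , nothing)
  x↦₁ = cong (a ,_) (ext₁ x∈G)
  x↦₂ : to₂ (x , x∈H) ≡ (b , nothing)
  x↦₂ = cong (b ,_) (ext₂ x∈H)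

  y-part₁ : Σ (Fin (NbPartition.k P₁ a)) λ A → to₁ (y , y∈G) ≡ (a , just A)
  y-part₁ = external-neighbour {T₁} {P₁} _ _ (ext₁ x∈G)
              (proj₁ (iso₁ (x , x∈G) (y , y∈G)) (proj₁ xy∈G×H))
  y-part₂ : Σ (Fin (NbPartition.k P₂ b)) λ B → to₂ (y , y∈H) ≡ (b , just B)
  y-part₂ = external-neighbour {T₂} {P₂} _ _ (ext₂ x∈H)
              (proj₁ (iso₂ (x , x∈H) (y , y∈H)) (proj₂ xy∈G×H))

  A : Fin (NbPartition.k P₁ a)
  A = proj₁ y-part₁
  B : Fin (NbPartition.k P₂ b)
  B = proj₁ y-part₂

  y↦₁ : to₁ (y , y∈G) ≡ (a , just A)
  y↦₁ = proj₂ y-part₁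
  y↦₂ : to₂ (y , y∈H) ≡ (b , just B)
  y↦₂ = proj₂ y-part₂

  open WedgeCorona T₁ P₁ T₂ P₂ a b A B public
  open ≡-Reasoning

  to₁-irrelevant : ∀ u (p q : T (V₁ u)) → to₁ (u , p) ≡ to₁ (u , q)
  to₁-irrelevant u p q = cong to₁ (vertex-≡ refl)

  to₂-irrelevant : ∀ u (p q : T (V₂ u)) → to₂ (u , p) ≡ to₂ (u , q)
  to₂-irrelevant u p q = cong to₂ (vertex-≡ refl)

  onlyH : ∀ {u} → T (V₁ u ∨ V₂ u) → ¬ T (V₁ u) → T (V₂ u)
  onlyH {u} p u∉G = [ (λ u∈G → ⊥-elim (u∉G u∈G)) , (λ u∈H → u∈H) ]′ (Equivalence.to (T-∨ {V₁ u}) p)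

  ψ : Vtx (G ∪ H) → CVertex
  ψ (u , p) with T? (V₁ u)
  ... | yes u∈G = κ₁ (to₁ (u , u∈G))
  ... | no  u∉G = κ₂ (to₂ (u , onlyH p u∉G))

  ψ-G : ∀ u p (u∈G : T (V₁ u)) → ψ (u , p) ≡ κ₁ (to₁ (u , u∈G))
  ψ-G u p u∈G with T? (V₁ u)
  ... | yes u∈G′ = cong κ₁ (to₁-irrelevant u u∈G′ u∈G)
  ... | no  u∉G  = ⊥-elim (u∉G u∈G)

  ψ-onlyH : ∀ u p (u∈H : T (V₂ u)) → ¬ T (V₁ u) → ψ (u , p) ≡ κ₂ (to₂ (u , u∈H))
  ψ-onlyH u p u∈H u∉G with T? (V₁ u)
  ... | yes u∈G  = ⊥-elim (u∉G u∈G)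
  ... | no  u∉G′ = cong κ₂ (to₂-irrelevant u _ u∈H)

  κ-shared : ∀ u (u∈G : T (V₁ u)) (u∈H : T (V₂ u)) → κ₁ (to₁ (u , u∈G)) ≡ κ₂ (to₂ (u , u∈H))
  κ-shared u u∈G u∈H with proj₁ (proj₁ shared u) (u∈G , u∈H)
  ... | inj₁ refl = begin
    κ₁ (to₁ (x , u∈G))    ≡⟨ cong κ₁ (trans (to₁-irrelevant x u∈G x∈G) x↦₁) ⟩
    κ₁ (a , nothing)      ≡⟨ κ₁-pivot nothing ⟩
    (hub , nothing)       ≡⟨ sym (κ₂-pivot nothing) ⟩
    κ₂ (b , nothing)      ≡⟨ cong κ₂ (trans (sym x↦₂) (to₂-irrelevant x x∈H u∈H)) ⟩
    κ₂ (to₂ (x , u∈H))    ∎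
  ... | inj₂ refl = begin
    κ₁ (to₁ (y , u∈G))              ≡⟨ cong κ₁ (trans (to₁-irrelevant y u∈G y∈G) y↦₁) ⟩
    κ₁ (a , just A)                 ≡⟨ κ₁-pivot (just A) ⟩
    (hub , just (mergeˡ A))         ≡⟨ cong (λ C → hub , just C) (sym mergeʳ-pivot) ⟩
    (hub , just (mergeʳ B))         ≡⟨ sym (κ₂-pivot (just B)) ⟩
    κ₂ (b , just B)                 ≡⟨ cong κ₂ (trans (sym y↦₂) (to₂-irrelevant y y∈H u∈H)) ⟩
    κ₂ (to₂ (y , u∈H))              ∎

  ψ-H : ∀ u p (u∈H : T (V₂ u)) → ψ (u , p) ≡ κ₂ (to₂ (u , u∈H))
  ψ-H u p u∈H = case T? (V₁ u) of λ where
    (yes u∈G) → trans (ψ-G u p u∈G) (κ-shared u u∈G u∈H)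
    (no  u∉G) → ψ-onlyH u p u∈H u∉G

  fromG : Vtx G → Vtx (G ∪ H)
  fromG (u , p) = u , Equivalence.from (T-∨ {V₁ u}) (inj₁ p)

  fromH : Vtx H → Vtx (G ∪ H)
  fromH (u , p) = u , Equivalence.from (T-∨ {V₁ u}) (inj₂ p)

  ψ⁻¹ : CVertex → Vtx (G ∪ H)
  ψ⁻¹ (hub , nothing) = fromG (x , x∈G)
  ψ⁻¹ (hub , just C)  = [ (λ C₁ → fromG (from₁ (a , just C₁)))
                        , (λ C₂ → fromH (from₂ (b , just (punchIn′ B C₂)))) ]′ (splitAt (k₁ a) C)
  ψ⁻¹ (inˡ j , m)     = fromG (from₁ (punchIn′ a j , m))
  ψ⁻¹ (inʳ j , m)     = fromH (from₂ (punchIn′ b j , m))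

  ψ-fromG : ∀ g → ψ (fromG (from₁ g)) ≡ κ₁ g
  ψ-fromG g = trans (ψ-G _ _ (proj₂ (from₁ g))) (cong κ₁ (to₁∘from₁ g))

  ψ-fromH : ∀ g → ψ (fromH (from₂ g)) ≡ κ₂ g
  ψ-fromH g = trans (ψ-H _ _ (proj₂ (from₂ g))) (cong κ₂ (to₂∘from₂ g))

  ψ∘ψ⁻¹ : ∀ g → ψ (ψ⁻¹ g) ≡ g
  ψ∘ψ⁻¹ (hub , nothing) = trans (ψ-G x _ x∈G) (trans (cong κ₁ x↦₁) (κ₁-pivot nothing))
  ψ∘ψ⁻¹ (hub , just C) with splitView (k₁ a) K′ C
  ... | onˡ C₁ rewrite splitAt-↑ˡ (k₁ a) C₁ K′ = trans (ψ-fromG (a , just C₁)) (κ₁-pivot (just C₁))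
  ... | onʳ C₂ rewrite splitAt-↑ʳ (k₁ a) K′ C₂ =
    trans (ψ-fromH (b , just (punchIn′ B C₂)))
          (trans (κ₂-pivot _) (cong (λ C → hub , just C) (mergeʳ-punched C₂)))
  ψ∘ψ⁻¹ (inˡ j , m) = trans (ψ-fromG _) (κ₁-punched j m)
  ψ∘ψ⁻¹ (inʳ j , m) = trans (ψ-fromH _) (κ₂-punched j m)

  from₁-of : ∀ {v g} → to₁ v ≡ g → from₁ g ≡ v
  from₁-of {v} e = trans (cong from₁ (sym e)) (from₁∘to₁ v)

  from₂-of : ∀ {v g} → to₂ v ≡ g → from₂ g ≡ v
  from₂-of {v} e = trans (cong from₂ (sym e)) (from₂∘to₂ v)

  ψ⁻¹∘κ₁ : ∀ g → proj₁ (ψ⁻¹ (κ₁ g)) ≡ proj₁ (from₁ g)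
  ψ⁻¹∘κ₁ (u , nothing) with punchView a u
  ... | pivot     = cong proj₁ (sym (from₁-of x↦₁))
  ... | punched j = refl
  ψ⁻¹∘κ₁ (u , just C) with punchView a u
  ... | pivot rewrite splitAt-↑ˡ (k₁ a) C K′ = refl
  ... | punched j = refl

  ψ⁻¹∘κ₂ : ∀ g → proj₁ (ψ⁻¹ (κ₂ g)) ≡ proj₁ (from₂ g)
  ψ⁻¹∘κ₂ (u , nothing) with punchView b u
  ... | pivot     = cong proj₁ (sym (from₂-of x↦₂))
  ... | punched j = refl
  ψ⁻¹∘κ₂ (u , just D) with punchView b u
  ... | punched j = refl
  ... | pivot with punchView B D
  ...   | pivot rewrite splitAt-↑ˡ (k₁ a) A K′ =
    trans (cong proj₁ (from₁-of y↦₁)) (sym (cong proj₁ (from₂-of y↦₂)))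
  ...   | punched j rewrite splitAt-↑ʳ (k₁ a) K′ j = refl

  ψ⁻¹∘ψ : ∀ v → ψ⁻¹ (ψ v) ≡ v
  ψ⁻¹∘ψ (u , p) = vertex-≡ ([ onG , onH ]′ (Equivalence.to (T-∨ {V₁ u}) p))
    where
    onG : T (V₁ u) → proj₁ (ψ⁻¹ (ψ (u , p))) ≡ u
    onG u∈G = trans (cong (proj₁ ∘ ψ⁻¹) (ψ-G u p u∈G))
                    (trans (ψ⁻¹∘κ₁ (to₁ (u , u∈G))) (cong proj₁ (from₁∘to₁ (u , u∈G))))
    onH : T (V₂ u) → proj₁ (ψ⁻¹ (ψ (u , p))) ≡ u
    onH u∈H = trans (cong (proj₁ ∘ ψ⁻¹) (ψ-H u p u∈H))
                    (trans (ψ⁻¹∘κ₂ (to₂ (u , u∈H))) (cong proj₁ (from₂∘to₂ (u , u∈H))))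

  ψ-bijection : Vtx (G ∪ H) ↔ CVertex
  ψ-bijection = mk↔ₛ′ ψ ψ⁻¹ ψ∘ψ⁻¹ ψ⁻¹∘ψ

  E∪ : U → U → Set
  E∪ u w = T (Graph.E (G ∪ H) u w)

  ψ-preserves : ∀ v w → E∪ (proj₁ v) (proj₁ w) → CEdge (ψ v) (ψ w)
  ψ-preserves (u , p) (w , q) e with Equivalence.to (T-∨ {E₁ u w}) e
  ... | inj₁ eG =
    let (u∈G , w∈G) = edge-endpoints G eG in
    subst₂ CEdge (sym (ψ-G u p u∈G)) (sym (ψ-G w q w∈G))
      (Equivalence.to (κ₁-adj _ _) (proj₁ (iso₁ (u , u∈G) (w , w∈G)) eG))
  ... | inj₂ eH =
    let (u∈H , w∈H) = edge-endpoints H eH in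
    subst₂ CEdge (sym (ψ-H u p u∈H)) (sym (ψ-H w q w∈H))
      (Equivalence.to (κ₂-adj _ _) (proj₁ (iso₂ (u , u∈H) (w , w∈H)) eH))

  to₁-injective : ∀ {v w g} → to₁ v ≡ g → to₁ w ≡ g → proj₁ v ≡ proj₁ w
  to₁-injective v↦ w↦ = cong proj₁ (trans (sym (from₁-of v↦)) (from₁-of w↦))

  to₂-injective : ∀ {v w g} → to₂ v ≡ g → to₂ w ≡ g → proj₁ v ≡ proj₁ w
  to₂-injective v↦ w↦ = cong proj₁ (trans (sym (from₂-of v↦)) (from₂-of w↦))

  E₂-from : ∀ {z w g} (z∈H : T (V₂ z)) (w∈H : T (V₂ w)) →
            to₂ (z , z∈H) ≡ g → CAdj T₂ P₂ g (to₂ (w , w∈H)) → T (E₂ z w)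
  E₂-from z∈H w∈H refl = proj₂ (iso₂ _ _)

  -- By κ-cross such an edge starts at x or y, where it is an edge of H.
  crossing-edge : ∀ u w (u∈G : T (V₁ u)) (w∈H : T (V₂ w)) → ¬ T (V₁ w) →
                  CEdge (κ₁ (to₁ (u , u∈G))) (κ₂ (to₂ (w , w∈H))) → T (E₂ u w)
  crossing-edge u w u∈G w∈H w∉G c
    with κ-cross (to₁ (u , u∈G)) (to₂ (w , w∈H)) (notShared x∈G x↦₂) (notShared y∈G y↦₂) c
    where
    notShared : ∀ {z z∈H g} → T (V₁ z) → to₂ (z , z∈H) ≡ g → to₂ (w , w∈H) ≢ g
    notShared z∈G z↦ w↦ = w∉G (subst (T ∘ V₁) (to₂-injective z↦ w↦) z∈G)
  ... | inj₁ (u↦ , c₂) = subst (λ z → T (E₂ z w)) (to₁-injective x↦₁ u↦) (E₂-from x∈H w∈H x↦₂ c₂)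
  ... | inj₂ (u↦ , c₂) = subst (λ z → T (E₂ z w)) (to₁-injective y↦₁ u↦) (E₂-from y∈H w∈H y↦₂ c₂)

  E∪-G : ∀ {u w} → T (E₁ u w) → E∪ u w
  E∪-G {u} {w} e = Equivalence.from (T-∨ {E₁ u w}) (inj₁ e)

  E∪-H : ∀ {u w} → T (E₂ u w) → E∪ u w
  E∪-H {u} {w} e = Equivalence.from (T-∨ {E₁ u w}) (inj₂ e)

  ψ-reflects : ∀ v w → CEdge (ψ v) (ψ w) → E∪ (proj₁ v) (proj₁ w)
  ψ-reflects (u , p) (w , q) c with T? (V₁ u) | T? (V₁ w)
  ... | yes u∈G | yes w∈G = E∪-G (proj₂ (iso₁ (u , u∈G) (w , w∈G)) (Equivalence.from (κ₁-adj _ _) c))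
  ... | no  u∉G | no  w∉G =
    E∪-H (proj₂ (iso₂ (u , onlyH p u∉G) (w , onlyH q w∉G)) (Equivalence.from (κ₂-adj _ _) c))
  ... | yes u∈G | no  w∉G = E∪-H (crossing-edge u w u∈G (onlyH q w∉G) w∉G c)
  ... | no  u∉G | yes w∈G =
    subst T (Graph.E-sym (G ∪ H) w u) (E∪-H (crossing-edge w u w∈G (onlyH p u∉G) u∉G (CEdge-sym _ _ c)))

  ψ-edge : ∀ v w → E∪ (proj₁ v) (proj₁ w) ⇔ CEdge (ψ v) (ψ w)
  ψ-edge v w = mk⇔ (ψ-preserves v w) (ψ-reflects v w)

  union-iso : IsIso (G ∪ H) wedge wedgePartition (↔-sym enumerate ↔-∘ ψ-bijection)
  union-iso v w = Equivalence.to edge⇔ , Equivalence.from edge⇔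
    where
    edge⇔ : E∪ (proj₁ v) (proj₁ w)
            ⇔ CAdj wedge wedgePartition (Inverse.from enumerate (ψ v)) (Inverse.from enumerate (ψ w))
    edge⇔ = CEdge⇔CAdj (ψ v) (ψ w) ⇔-∘ ψ-edge v w

mainTheorem5 : {U : Set} (G H : Graph U) (x y : U) →
    ShareOnlyEdge G H x y →
    IsGenCoronaExt G x →
    IsGenCoronaExt H x →
    IsGenCorona (G ∪ H)
mainTheorem5 G H x y shared (T₁ , P₁ , φ₁ , iso₁ , ext₁) (T₂ , P₂ , φ₂ , iso₂ , ext₂) =
  wedge , wedgePartition , ↔-sym enumerate ↔-∘ ψ-bijection , union-iso
  where open Union G H x y shared T₁ P₁ φ₁ iso₁ ext₁ T₂ P₂ φ₂ iso₂ ext₂
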